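{- Let $p$ be an odd prime, and let $n=\frac{p-1}{2}q+r$ with $q\in\{1,2,3,\ldots\}$ and $r\in\{0,1,\ldots,(p-3)/2\}$. Then $$s(n)\equiv s(r)+(q-1)\delta_{r,0}\pmod p,$$ where $s(m)=\sum_{k=0}^{m}E_{2k}E_{2m-2k}$ for integers $m\ge 0$ and $\delta_{r,0}$ is the Kronecker delta.
   Context: The Euler numbers $E_n$ ($n=0,1,2,\ldots$) are the integers defined by $E_0=1$ and $\sum_{0\le k\le n,\ 2\mid k}\binom{n}{k}E_{n-k}=0$ for all $n\ge 1$; equivalently $\frac{2e^x}{e^{2x}+1}=\sum_{n\ge0}E_n\frac{x^n}{n!}$. -}

module Defs where

open import Data.Nat using (ℕ; zero; suc; _∸_; _≤ᵇ_; _/_)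
import Data.Nat as N
open import Data.Nat.Combinatorics using (_C_)
open import Data.Integer using (ℤ; +_; -_; _+_; _*_)
open import Data.Bool using (if_then_else_)

sum1 : ℕ → (ℕ → ℤ) → ℤ
sum1 zero    f = + 0
sum1 (suc k) f = sum1 k f + f (suc k)

sum0 : ℕ → (ℕ → ℤ) → ℤ
sum0 zero    f = f 0
sum0 (suc m) f = sum0 m f + f (suc m)

-- table n m = E_m for all m ≤ n (values for m > n are junk)
-- Recurrence: for n ≥ 1, Σ_{0≤k≤n, k even} C(n,k) E_{n-k} = 0, i.e.
--   E_n = - Σ_{j=1}^{⌊n/2⌋} C(n,2j) E_{n-2j}.
eulerTable : ℕ → ℕ → ℤ
eulerTable zero    m = + 1
eulerTable (suc n) m =
  if m ≤ᵇ n then eulerTable n m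
  else - sum1 (suc n / 2) (λ j → (+ (suc n C (2 N.* j))) * eulerTable n (suc n ∸ 2 N.* j))

E : ℕ → ℤ
E n = eulerTable n n

s : ℕ → ℤ
s m = sum0 m (λ k → E (2 N.* k) * E (2 N.* m ∸ 2 N.* k))

δ0 : ℕ → ℤ
δ0 zero    = + 1
δ0 (suc _) = + 0

module Submission where

-- Put a_j = 2j + 1 and x_j = a_j² for j < p.
--  1. E_n ≡ F_n = Σ_{j<p} (-1)^j a_j^n: F obeys the recurrence defining E, since
--     the even parts of the binomial expansions of (a_j ± 1)^n telescope.
--  2. Hence s(m) ≡ T_m = Σ_{j,l<p} (-1)^(j+l) H_m(x_j, x_l), where H_m(x, y) =
--     Σ_{k≤m} x^k y^(m-k) is the complete homogeneous polynomial.
--  3. By Fermat x^(h+1) ≡ x for squares, so H_m(x_j, x_l) is h-periodic in m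
--     unless x_j ≡ x_l, i.e. l ∈ {j, 2h - j}; these entries give
--     T_(m+h) - T_m ≡ -U_(2m) for the power sums U_k = Σ_{j<p} a_j^k.
--  4. U_k ≡ 0 for k < 2h, U_(2h) ≡ -1 and U is 2h-periodic on k > 0; telescoping
--     step 3 over the blocks m = hi + r, i ≤ q, gives the corollary.

open import Defs
open import Data.Nat using (ℕ; _≤_; _/_; _∸_)
import Data.Nat as ℕ
open import Data.Nat.Primality using (Prime)
open import Data.Integer using (ℤ; +_; _+_; _*_; _-_)
open import Data.Integer.Divisibility using (_∣_)

open import Data.Nat using (zero; suc; _<_; z≤n; s≤s; _≟_)
import Data.Nat.Properties as ℕP
open import Data.Integer using (-_; _^_; 0ℤ; 1ℤ; -1ℤ; ∣_∣)
import Data.Integer.Properties as ℤP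
open import Data.Integer.Tactic.RingSolver using (solve-∀)
open import Data.Nat.Tactic.RingSolver using () renaming (solve-∀ to ℕ-solve-∀)
open import Data.Nat.Combinatorics using (_C_; nCn≡1; nC1≡n; nCk≡nC[n∸k]; k>n⇒nCk≡0; nCk+nC[k+1]≡[n+1]C[k+1])
open import Data.Nat.DivMod using (_%_; m≡m%n+[m/n]*n; m%n<n; m*n/n≡m)
open import Data.Fin using (toℕ)
open import Relation.Binary.PropositionalEquality
open import Relation.Binary.Bundles using (Setoid)
open import Relation.Nullary using (¬_; yes; no)
open import Data.Empty using (⊥-elim)
open import Data.Nat.Induction using (<-rec)
open import Data.Bool using (true; false)
import Data.Bool as Bool
open import Data.Unit using (tt)
import Relation.Binary.Reasoning.Setoid as ≈-Reasoning
open import Data.Product using (Σ; _,_)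
open import Data.Sum using (_⊎_; inj₁; inj₂)
import Data.Sum as Sum
open import Data.Nat.Primality using (euclidsLemma; prime⇒irreducible)
import Data.Nat.Divisibility as ℕD
import Data.Integer.Divisibility.Signed as Signed
import Algebra.Properties.CommutativeSemiring.Binomial ℤP.+-*-commutativeSemiring as Binomial
import Algebra.Properties.Semiring.Exp ℤP.+-*-semiring as SemiringExp
import Algebra.Properties.Monoid.Mult ℤP.+-0-monoid as MonoidMult
import Algebra.Properties.Monoid.Sum ℤP.+-0-monoid as MonoidSum

∑ : ℕ → (ℕ → ℤ) → ℤ
∑ zero    f = 0ℤ
∑ (suc n) f = ∑ n f + f n

∑-cong : ∀ n {f g : ℕ → ℤ} → (∀ i → i < n → f i ≡ g i) → ∑ n f ≡ ∑ n g
∑-cong zero    eq = refl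
∑-cong (suc n) eq = cong₂ _+_ (∑-cong n (λ i i<n → eq i (ℕP.m<n⇒m<1+n i<n))) (eq n ℕP.≤-refl)

∑-ext : ∀ n {f g : ℕ → ℤ} → (∀ i → f i ≡ g i) → ∑ n f ≡ ∑ n g
∑-ext n eq = ∑-cong n (λ i _ → eq i)

∑-+ : ∀ n (f g : ℕ → ℤ) → ∑ n (λ i → f i + g i) ≡ ∑ n f + ∑ n g
∑-+ zero    f g = refl
∑-+ (suc n) f g = trans (cong (_+ (f n + g n)) (∑-+ n f g)) (swap (∑ n f) (∑ n g) (f n) (g n))
  where
    swap : ∀ a b c d → (a + b) + (c + d) ≡ (a + c) + (b + d)
    swap = solve-∀

∑-*ˡ : ∀ n c (f : ℕ → ℤ) → c * ∑ n f ≡ ∑ n (λ i → c * f i)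
∑-*ˡ zero    c f = ℤP.*-zeroʳ c
∑-*ˡ (suc n) c f = trans (ℤP.*-distribˡ-+ c (∑ n f) (f n)) (cong (_+ c * f n) (∑-*ˡ n c f))

∑-neg : ∀ n (f : ℕ → ℤ) → - ∑ n f ≡ ∑ n (λ i → - f i)
∑-neg zero    f = refl
∑-neg (suc n) f = trans (ℤP.neg-distrib-+ (∑ n f) (f n)) (cong (_+ - f n) (∑-neg n f))

∑-- : ∀ n (f g : ℕ → ℤ) → ∑ n (λ i → f i - g i) ≡ ∑ n f - ∑ n g
∑-- n f g = trans (∑-+ n f (λ i → - g i)) (cong (_+_ (∑ n f)) (sym (∑-neg n g)))

∑-const : ∀ n c → ∑ n (λ _ → c) ≡ + n * c
∑-const zero    c = sym (ℤP.*-zeroˡ c)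
∑-const (suc n) c = trans (cong (_+ c) (∑-const n c)) (step (+ n) c)
  where
    step : ∀ m c → m * c + c ≡ (1ℤ + m) * c
    step = solve-∀

∑-zero : ∀ n (f : ℕ → ℤ) → (∀ i → i < n → f i ≡ 0ℤ) → ∑ n f ≡ 0ℤ
∑-zero n f eq = trans (∑-cong n eq) (trans (∑-const n 0ℤ) (ℤP.*-zeroʳ (+ n)))

∑-swap : ∀ n m (f : ℕ → ℕ → ℤ) → ∑ n (λ i → ∑ m (f i)) ≡ ∑ m (λ j → ∑ n (λ i → f i j))
∑-swap zero    m f = sym (∑-zero m _ (λ _ _ → refl))
∑-swap (suc n) m f =
  trans (cong (_+ ∑ m (f n)) (∑-swap n m f)) (sym (∑-+ m (λ j → ∑ n (λ i → f i j)) (f n)))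

∑-product : ∀ n m (f g : ℕ → ℤ) → ∑ n f * ∑ m g ≡ ∑ n (λ i → ∑ m (λ j → f i * g j))
∑-product n m f g = begin
  ∑ n f * ∑ m g                         ≡⟨ ℤP.*-comm (∑ n f) (∑ m g) ⟩
  ∑ m g * ∑ n f                         ≡⟨ ∑-*ˡ n (∑ m g) f ⟩
  ∑ n (λ i → ∑ m g * f i)               ≡⟨ ∑-ext n (λ i → ℤP.*-comm (∑ m g) (f i)) ⟩
  ∑ n (λ i → f i * ∑ m g)               ≡⟨ ∑-ext n (λ i → ∑-*ˡ m (f i) g) ⟩
  ∑ n (λ i → ∑ m (λ j → f i * g j))     ∎
  where open ≡-Reasoning

∑-shift : ∀ n (f : ℕ → ℤ) → ∑ (suc n) f ≡ f 0 + ∑ n (λ i → f (suc i))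
∑-shift zero    f = trans (ℤP.+-identityˡ (f 0)) (sym (ℤP.+-identityʳ (f 0)))
∑-shift (suc n) f = trans (cong (_+ f (suc n)) (∑-shift n f)) (ℤP.+-assoc (f 0) _ _)

∑-telescope : ∀ n (g : ℕ → ℤ) → ∑ n (λ i → g (suc i) - g i) ≡ g n - g 0
∑-telescope zero    g = sym (ℤP.+-inverseʳ (g 0))
∑-telescope (suc n) g =
  trans (cong (_+ (g (suc n) - g n)) (∑-telescope n g)) (collapse (g n) (g 0) (g (suc n)))
  where
    collapse : ∀ a b c → (a - b) + (c - a) ≡ c - b
    collapse = solve-∀

∑-pad : ∀ m d (f : ℕ → ℤ) → (∀ i → m ≤ i → f i ≡ 0ℤ) → ∑ (d ℕ.+ m) f ≡ ∑ m f
∑-pad m zero    f vanish = refl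
∑-pad m (suc d) f vanish =
  trans (cong₂ _+_ (∑-pad m d f vanish) (vanish (d ℕ.+ m) (ℕP.m≤n+m m d))) (ℤP.+-identityʳ (∑ m f))

sum0≡∑ : ∀ m f → sum0 m f ≡ ∑ (suc m) f
sum0≡∑ zero    f = sym (ℤP.+-identityˡ (f 0))
sum0≡∑ (suc m) f = cong (_+ f (suc m)) (sum0≡∑ m f)

sum1≡∑ : ∀ k f → sum1 k f ≡ ∑ k (λ i → f (suc i))
sum1≡∑ zero    f = refl
sum1≡∑ (suc k) f = cong (_+ f (suc k)) (sum1≡∑ k f)

pascal : ∀ n k → suc n C suc k ≡ n C k ℕ.+ n C suc k
pascal n k = sym (nCk+nC[k+1]≡[n+1]C[k+1] n k)

-- Absorption identity (k+1)·C(n+1,k+1) = (n+1)·C(n,k); it shows p ∣ C(p,k) for 0<k<p.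
absorption : ∀ n k → suc k ℕ.* (suc n C suc k) ≡ suc n ℕ.* (n C k)
absorption zero zero = refl
absorption zero (suc k) = begin
  suc (suc k) ℕ.* (1 C suc (suc k)) ≡⟨ cong (suc (suc k) ℕ.*_) (k>n⇒nCk≡0 {1} {suc (suc k)} (s≤s (s≤s z≤n))) ⟩
  suc (suc k) ℕ.* 0                 ≡⟨ ℕP.*-zeroʳ (suc (suc k)) ⟩
  0                                 ≡⟨ cong (1 ℕ.*_) (k>n⇒nCk≡0 {0} {suc k} (s≤s z≤n)) ⟨
  1 ℕ.* (0 C suc k)                 ∎
  where open ≡-Reasoning
absorption (suc n) zero = trans (ℕP.*-identityˡ _) (trans (nC1≡n (suc (suc n))) (sym (ℕP.*-identityʳ _)))
absorption (suc n) (suc k) = begin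
  suc (suc k) ℕ.* (suc (suc n) C suc (suc k))
    ≡⟨ cong (suc (suc k) ℕ.*_) (pascal (suc n) (suc k)) ⟩
  suc (suc k) ℕ.* (suc n C suc k ℕ.+ suc n C suc (suc k))
    ≡⟨ ℕP.*-distribˡ-+ (suc (suc k)) (suc n C suc k) _ ⟩
  suc (suc k) ℕ.* (suc n C suc k) ℕ.+ suc (suc k) ℕ.* (suc n C suc (suc k))
    ≡⟨ cong₂ (λ u v → suc n C suc k ℕ.+ u ℕ.+ v) (absorption n k) (absorption n (suc k)) ⟩
  suc n C suc k ℕ.+ suc n ℕ.* (n C k) ℕ.+ suc n ℕ.* (n C suc k)
    ≡⟨ ℕP.+-assoc (suc n C suc k) _ _ ⟩
  suc n C suc k ℕ.+ (suc n ℕ.* (n C k) ℕ.+ suc n ℕ.* (n C suc k))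
    ≡⟨ cong (suc n C suc k ℕ.+_) (ℕP.*-distribˡ-+ (suc n) (n C k) _) ⟨
  suc n C suc k ℕ.+ suc n ℕ.* (n C k ℕ.+ n C suc k)
    ≡⟨ cong (λ c → suc n C suc k ℕ.+ suc n ℕ.* c) (pascal n k) ⟨
  suc (suc n) ℕ.* (suc n C suc k) ∎
  where open ≡-Reasoning

-- The binomial theorem of the library, restated with ∑ and the integer
-- operations (the library phrases it with Fin-indexed sums and monoid powers).
binomial-theorem : ∀ x y n → (x + y) ^ n ≡ ∑ (suc n) (λ k → + (n C k) * (x ^ k * y ^ (n ∸ k)))
binomial-theorem x y n = begin
  (x + y) ^ n
    ≡⟨ ^≡^ (x + y) n ⟨
  (x + y) SemiringExp.^ n
    ≡⟨ Binomial.theorem n x y ⟩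
  Binomial.binomialExpansion x y n
    ≡⟨ MonoidSum.sum-cong-≗ {suc n} (λ i → term (toℕ i)) ⟩
  MonoidSum.sum {suc n} (λ i → + (n C toℕ i) * (x ^ toℕ i * y ^ (n ∸ toℕ i)))
    ≡⟨ sum≡∑ (suc n) _ ⟩
  ∑ (suc n) (λ k → + (n C k) * (x ^ k * y ^ (n ∸ k))) ∎
  where
    open ≡-Reasoning
    ×≡* : ∀ m z → m MonoidMult.× z ≡ + m * z
    ×≡* zero    z = sym (ℤP.*-zeroˡ z)
    ×≡* (suc m) z = trans (cong (_+_ z) (×≡* m z)) (sym (ℤP.suc-* (+ m) z))
    ^≡^ : ∀ z m → z SemiringExp.^ m ≡ z ^ m
    ^≡^ z zero    = refl
    ^≡^ z (suc m) = cong (z *_) (^≡^ z m)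
    sum≡∑ : ∀ m (f : ℕ → ℤ) → MonoidSum.sum {m} (λ i → f (toℕ i)) ≡ ∑ m f
    sum≡∑ zero    f = refl
    sum≡∑ (suc m) f = trans (cong (_+_ (f 0)) (sum≡∑ m (λ i → f (suc i)))) (sym (∑-shift m f))
    term : ∀ k → (n C k) MonoidMult.× ((x SemiringExp.^ k) * (y SemiringExp.^ (n ∸ k)))
                 ≡ + (n C k) * (x ^ k * y ^ (n ∸ k))
    term k = trans (×≡* (n C k) _) (cong (+ (n C k) *_) (cong₂ _*_ (^≡^ x k) (^≡^ y (n ∸ k))))

ε : ℕ → ℤ
ε j = -1ℤ ^ j

ε-even : ∀ k → ε (2 ℕ.* k) ≡ 1ℤ
ε-even k = trans (sym (ℤP.^-*-assoc -1ℤ 2 k)) (ℤP.^-zeroˡ k)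

ε-+ : ∀ j l → ε j * ε l ≡ ε (j ℕ.+ l)
ε-+ j l = sym (ℤP.^-distribˡ-+-* -1ℤ j l)

∑-even : ∀ K (t : ℕ → ℤ) → ∑ (2 ℕ.* K) (λ i → t i * (1ℤ + ε i)) ≡ + 2 * ∑ K (λ j → t (2 ℕ.* j))
∑-even zero    t = refl
∑-even (suc K) t = begin
  ∑ (2 ℕ.* suc K) f
    ≡⟨ cong (λ M → ∑ M f) (ℕP.*-suc 2 K) ⟩
  ∑ (2 ℕ.* K) f + f (2 ℕ.* K) + f (suc (2 ℕ.* K))
    ≡⟨ cong₂ (λ u v → u + t (2 ℕ.* K) * (1ℤ + v) + t (suc (2 ℕ.* K)) * (1ℤ + -1ℤ * v)) (∑-even K t) (ε-even K) ⟩
  + 2 * ∑ K (λ j → t (2 ℕ.* j)) + t (2 ℕ.* K) * (1ℤ + 1ℤ) + t (suc (2 ℕ.* K)) * (1ℤ + -1ℤ * 1ℤ)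
    ≡⟨ collect (∑ K (λ j → t (2 ℕ.* j))) (t (2 ℕ.* K)) (t (suc (2 ℕ.* K))) ⟩
  + 2 * ∑ (suc K) (λ j → t (2 ℕ.* j)) ∎
  where
    open ≡-Reasoning
    f = λ i → t i * (1ℤ + ε i)
    collect : ∀ a b c → + 2 * a + b * (1ℤ + 1ℤ) + c * (1ℤ + -1ℤ * 1ℤ) ≡ + 2 * (a + b)
    collect = solve-∀

even-binomial : ∀ N y → (1ℤ + y) ^ N + (-1ℤ + y) ^ N
                         ≡ + 2 * ∑ (suc (N / 2)) (λ j → + (N C (2 ℕ.* j)) * y ^ (N ∸ 2 ℕ.* j))
even-binomial N y = begin
  (1ℤ + y) ^ N + (-1ℤ + y) ^ N
    ≡⟨ cong₂ _+_ (binomial-theorem 1ℤ y N) (binomial-theorem -1ℤ y N) ⟩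
  ∑ (suc N) (term 1ℤ) + ∑ (suc N) (term -1ℤ)
    ≡⟨ ∑-+ (suc N) (term 1ℤ) (term -1ℤ) ⟨
  ∑ (suc N) (λ i → term 1ℤ i + term -1ℤ i)
    ≡⟨ ∑-ext (suc N) pair ⟩
  ∑ (suc N) t±
    ≡⟨ ∑-pad (suc N) (2 ℕ.* suc (N / 2) ∸ suc N) t± beyond ⟨
  ∑ (2 ℕ.* suc (N / 2) ∸ suc N ℕ.+ suc N) t±
    ≡⟨ cong (λ M → ∑ M t±) (ℕP.m∸n+n≡m (bound N)) ⟩
  ∑ (2 ℕ.* suc (N / 2)) t±
    ≡⟨ ∑-even (suc (N / 2)) t ⟩
  + 2 * ∑ (suc (N / 2)) (λ j → + (N C (2 ℕ.* j)) * y ^ (N ∸ 2 ℕ.* j)) ∎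
  where
    open ≡-Reasoning
    term : ℤ → ℕ → ℤ
    term x i = + (N C i) * (x ^ i * y ^ (N ∸ i))
    t : ℕ → ℤ
    t i = + (N C i) * y ^ (N ∸ i)
    t± : ℕ → ℤ
    t± i = t i * (1ℤ + ε i)
    pair : ∀ i → term 1ℤ i + term -1ℤ i ≡ t± i
    pair i = trans (cong (λ u → + (N C i) * (u * y ^ (N ∸ i)) + term -1ℤ i) (ℤP.^-zeroˡ i))
                   (factor (+ (N C i)) (ε i) (y ^ (N ∸ i)))
      where
        factor : ∀ c e z → c * (1ℤ * z) + c * (e * z) ≡ c * z * (1ℤ + e)
        factor = solve-∀
    beyond : ∀ i → suc N ≤ i → t± i ≡ 0ℤ
    beyond i N<i = trans (cong (λ c → + c * y ^ (N ∸ i) * (1ℤ + ε i)) (k>n⇒nCk≡0 N<i))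
                         (trans (cong (_* (1ℤ + ε i)) (ℤP.*-zeroˡ (y ^ (N ∸ i)))) (ℤP.*-zeroˡ (1ℤ + ε i)))
    bound : ∀ N → suc N ≤ 2 ℕ.* suc (N / 2)
    bound N = ℕP.≤-trans (ℕP.≤-reflexive (cong suc (m≡m%n+[m/n]*n N 2)))
                (ℕP.≤-trans (ℕP.+-monoˡ-≤ ((N / 2) ℕ.* 2) (m%n<n N 2))
                  (ℕP.≤-reflexive (trans (cong (2 ℕ.+_) (ℕP.*-comm (N / 2) 2)) (sym (ℕP.*-suc 2 (N / 2))))))

-- Congruence of integers modulo a fixed natural number p.  It is wrapped in
-- a record so that the two sides can be inferred from a proof.
module Congruence (p : ℕ) where

  infix 4 _≈_
  record _≈_ (a b : ℤ) : Set where
    constructor mk≈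
    field divides-difference : + p Signed.∣ (a - b)

  ≈-reflexive : ∀ {a b} → a ≡ b → a ≈ b
  ≈-reflexive {a} refl = mk≈ (Signed.divides 0ℤ (trans (ℤP.+-inverseʳ a) (sym (ℤP.*-zeroˡ (+ p)))))

  ≈-refl : ∀ {a} → a ≈ a
  ≈-refl = ≈-reflexive refl

  private
    by : ∀ {a b} → a ≡ b → + p Signed.∣ a → + p Signed.∣ b
    by = subst (+ p Signed.∣_)

  ≈-sym : ∀ {a b} → a ≈ b → b ≈ a
  ≈-sym {a} {b} (mk≈ d) = mk≈ (by (flip a b) (Signed.∣m⇒∣-m d))
    where
      flip : ∀ a b → - (a - b) ≡ b - a
      flip = solve-∀

  ≈-trans : ∀ {a b c} → a ≈ b → b ≈ c → a ≈ c
  ≈-trans {a} {b} {c} (mk≈ d) (mk≈ e) = mk≈ (by (chain a b c) (Signed.∣m∣n⇒∣m+n d e))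
    where
      chain : ∀ a b c → (a - b) + (b - c) ≡ a - c
      chain = solve-∀

  ≈-setoid : Setoid _ _
  ≈-setoid = record { Carrier = ℤ ; _≈_ = _≈_
                    ; isEquivalence = record { refl = ≈-refl ; sym = ≈-sym ; trans = ≈-trans } }

  +-cong : ∀ {a b c d} → a ≈ b → c ≈ d → a + c ≈ b + d
  +-cong {a} {b} {c} {d} (mk≈ e) (mk≈ f) = mk≈ (by (regroup a b c d) (Signed.∣m∣n⇒∣m+n e f))
    where
      regroup : ∀ a b c d → (a - b) + (c - d) ≡ (a + c) - (b + d)
      regroup = solve-∀

  neg-cong : ∀ {a b} → a ≈ b → - a ≈ - b
  neg-cong {a} {b} (mk≈ e) = mk≈ (by (regroup a b) (Signed.∣m⇒∣-m e))
    where
      regroup : ∀ a b → - (a - b) ≡ (- a) - (- b)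
      regroup = solve-∀

  -‿cong : ∀ {a b c d} → a ≈ b → c ≈ d → a - c ≈ b - d
  -‿cong e f = +-cong e (neg-cong f)

  *-cong : ∀ {a b c d} → a ≈ b → c ≈ d → a * c ≈ b * d
  *-cong {a} {b} {c} {d} (mk≈ e) (mk≈ f) =
    mk≈ (by (regroup a b c d) (Signed.∣m∣n⇒∣m+n (Signed.∣n⇒∣m*n c e) (Signed.∣n⇒∣m*n b f)))
    where
      regroup : ∀ a b c d → c * (a - b) + b * (c - d) ≡ a * c - b * d
      regroup = solve-∀

  ^-cong : ∀ {a b} n → a ≈ b → a ^ n ≈ b ^ n
  ^-cong zero    e = ≈-refl
  ^-cong (suc n) e = *-cong e (^-cong n e)

  ∑-cong≈ : ∀ n {f g : ℕ → ℤ} → (∀ i → i < n → f i ≈ g i) → ∑ n f ≈ ∑ n g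
  ∑-cong≈ zero    eq = ≈-refl
  ∑-cong≈ (suc n) eq = +-cong (∑-cong≈ n (λ i i<n → eq i (ℕP.m<n⇒m<1+n i<n))) (eq n ℕP.≤-refl)

  ≈0⇒∣ : ∀ {a} → a ≈ 0ℤ → + p Signed.∣ a
  ≈0⇒∣ {a} (mk≈ d) = by (ℤP.+-identityʳ a) d

  ∣⇒≈0 : ∀ {a} → + p Signed.∣ a → a ≈ 0ℤ
  ∣⇒≈0 {a} d = mk≈ (by (sym (ℤP.+-identityʳ a)) d)

  ≈⇒-≈0 : ∀ {a b} → a ≈ b → a - b ≈ 0ℤ
  ≈⇒-≈0 (mk≈ d) = ∣⇒≈0 d

  -≈0⇒≈ : ∀ {a b} → a - b ≈ 0ℤ → a ≈ b
  -≈0⇒≈ d = mk≈ (≈0⇒∣ d)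

  p≈0 : + p ≈ 0ℤ
  p≈0 = ∣⇒≈0 Signed.∣-refl

  small≈0 : ∀ {n} → + n ≈ 0ℤ → n < p → n ≡ 0
  small≈0 {zero}  _ _   = refl
  small≈0 {suc n} e n<p = ⊥-elim (ℕP.<⇒≱ n<p (ℕD.∣⇒≤ (Signed.∣⇒∣ᵤ (≈0⇒∣ e))))

  ≈⇒≡-ordered : ∀ {m n} → m ≤ n → n < p → + n ≈ + m → n ≡ m
  ≈⇒≡-ordered {m} {n} m≤n n<p n≈m = ℕP.≤-antisym (ℕP.m∸n≡0⇒m≤n n∸m≡0) m≤n
    where
      difference : + n - + m ≡ + (n ∸ m)
      difference = trans (ℤP.m-n≡m⊖n n m) (ℤP.⊖-≥ m≤n)
      n∸m≡0 : n ∸ m ≡ 0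
      n∸m≡0 = small≈0 (≈-trans (≈-reflexive (sym difference)) (≈⇒-≈0 n≈m))
                      (ℕP.≤-<-trans (ℕP.m∸n≤m n m) n<p)

  ≈⇒≡ : ∀ {j l} → j < p → l < p → + j ≈ + l → j ≡ l
  ≈⇒≡ {j} {l} j<p l<p j≈l with ℕP.≤-total j l
  ... | inj₁ j≤l = sym (≈⇒≡-ordered j≤l l<p (≈-sym j≈l))
  ... | inj₂ l≤j = ≈⇒≡-ordered l≤j j<p j≈l

  multiple-below-2p : ∀ {n} → + suc n ≈ 0ℤ → suc n < p ℕ.+ p → suc n ≡ p
  multiple-below-2p e n<2p with Signed.∣⇒∣ᵤ (≈0⇒∣ e)
  ... | ℕD.divides zero            ()
  ... | ℕD.divides (suc zero)      n≡p = trans n≡p (ℕP.+-identityʳ p)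
  ... | ℕD.divides (suc (suc k)) n≡2p+ =
    ⊥-elim (ℕP.<⇒≱ n<2p (ℕP.≤-trans (ℕP.+-monoʳ-≤ p (ℕP.m≤m+n p (k ℕ.* p))) (ℕP.≤-reflexive (sym n≡2p+))))

  ∑-vanish : ∀ n (f : ℕ → ℤ) → (∀ i → i < n → f i ≈ 0ℤ) → ∑ n f ≈ 0ℤ
  ∑-vanish n f off = ≈-trans (∑-cong≈ n off) (≈-reflexive (∑-zero n (λ _ → 0ℤ) (λ _ _ → refl)))

  private
    below : ∀ {u n} → u < suc n → u ≢ n → u < n
    below u<1+n u≢n = ℕP.≤∧≢⇒< (ℕP.≤-pred u<1+n) u≢n

  ∑-support₁ : ∀ n (f : ℕ → ℤ) u → u < n → (∀ i → i < n → i ≢ u → f i ≈ 0ℤ) → ∑ n f ≈ f u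
  ∑-support₁ (suc n) f u u<1+n off with u ≟ n
  ... | yes refl =
    ≈-trans (+-cong (∑-vanish n f (λ i i<n → off i (ℕP.m<n⇒m<1+n i<n) (λ i≡u → ℕP.<-irrefl i≡u i<n))) ≈-refl)
            (≈-reflexive (ℤP.+-identityˡ (f u)))
  ... | no u≢n =
    ≈-trans (+-cong (∑-support₁ n f u (below u<1+n u≢n)
                                (λ i i<n → off i (ℕP.m<n⇒m<1+n i<n)))
                    (off n ℕP.≤-refl (λ n≡u → u≢n (sym n≡u))))
            (≈-reflexive (ℤP.+-identityʳ (f u)))

  ∑-support₂ : ∀ n (f : ℕ → ℤ) u v → u < n → v < n → u ≢ v →
               (∀ i → i < n → i ≢ u → i ≢ v → f i ≈ 0ℤ) → ∑ n f ≈ f u + f v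
  ∑-support₂ (suc n) f u v u<1+n v<1+n u≢v off with n ≟ u | n ≟ v
  ... | yes refl | _ =
    ≈-trans (+-cong (∑-support₁ n f v (below v<1+n (λ v≡n → u≢v (sym v≡n)))
                      (λ i i<n i≢v → off i (ℕP.m<n⇒m<1+n i<n) (λ i≡n → ℕP.<-irrefl i≡n i<n) i≢v))
                    ≈-refl)
            (≈-reflexive (ℤP.+-comm (f v) (f n)))
  ... | no _ | yes refl =
    +-cong (∑-support₁ n f u (below u<1+n u≢v)
             (λ i i<n i≢u → off i (ℕP.m<n⇒m<1+n i<n) i≢u (λ i≡n → ℕP.<-irrefl i≡n i<n)))
           ≈-refl
  ... | no n≢u | no n≢v =
    ≈-trans (+-cong (∑-support₂ n f u v (below u<1+n (λ u≡n → n≢u (sym u≡n)))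
                                        (below v<1+n (λ v≡n → n≢v (sym v≡n))) u≢v
                                        (λ i i<n → off i (ℕP.m<n⇒m<1+n i<n)))
                    (off n ℕP.≤-refl n≢u n≢v))
            (≈-reflexive (ℤP.+-identityʳ (f u + f v)))

  module PrimeModulus (p-prime : Prime p) where

    zero-divisor : ∀ a b → a * b ≈ 0ℤ → a ≈ 0ℤ ⊎ b ≈ 0ℤ
    zero-divisor a b ab≈0 =
      Sum.map (λ p∣a → ∣⇒≈0 (Signed.∣ᵤ⇒∣ p∣a)) (λ p∣b → ∣⇒≈0 (Signed.∣ᵤ⇒∣ p∣b))
              (euclidsLemma ∣ a ∣ ∣ b ∣ p-prime (subst (p ℕD.∣_) (ℤP.abs-* a b) (Signed.∣⇒∣ᵤ (≈0⇒∣ ab≈0))))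

    cancelˡ : ∀ c {a b} → ¬ (c ≈ 0ℤ) → c * a ≈ c * b → a ≈ b
    cancelˡ c {a} {b} c≉0 ca≈cb =
      Sum.[ (λ c≈0 → ⊥-elim (c≉0 c≈0)) , -≈0⇒≈ ]′
        (zero-divisor c (a - b) (≈-trans (≈-reflexive (distrib c a b)) (≈⇒-≈0 ca≈cb)))
      where
        distrib : ∀ c a b → c * (a - b) ≡ c * a - c * b
        distrib = solve-∀

-- Fermat's little theorem for a prime p = n + 1, via the freshman's dream
-- (a + 1)^p ≡ a^p + 1, whose middle binomial coefficients vanish modulo p.
module Fermat (n : ℕ) (p-prime : Prime (suc n)) where

  p = suc n
  open Congruence p
  open PrimeModulus p-prime

  prime∣binomial : ∀ i → 0 < i → i < p → + (p C i) ≈ 0ℤ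
  prime∣binomial (suc k) _ k<n
    with euclidsLemma (suc k) (p C suc k) p-prime
           (ℕD.divides (n C k) (trans (absorption n k) (ℕP.*-comm p (n C k))))
  ... | inj₁ p∣k+1 = ⊥-elim (ℕP.<⇒≱ k<n (ℕD.∣⇒≤ p∣k+1))
  ... | inj₂ p∣C   = ∣⇒≈0 (Signed.∣ᵤ⇒∣ p∣C)

  freshman : ∀ a → (a + 1ℤ) ^ p ≈ a ^ p + 1ℤ
  freshman a = begin
    (a + 1ℤ) ^ p              ≡⟨ binomial-theorem a 1ℤ p ⟩
    ∑ (suc p) term            ≈⟨ ∑-support₂ (suc p) term p 0 ℕP.≤-refl (s≤s z≤n) (λ ()) middle ⟩
    term p + term 0           ≡⟨ cong₂ _+_ last first ⟩
    a ^ p + 1ℤ                ∎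
    where
      open ≈-Reasoning ≈-setoid
      term : ℕ → ℤ
      term k = + (p C k) * (a ^ k * 1ℤ ^ (p ∸ k))
      middle : ∀ k → k < suc p → k ≢ p → k ≢ 0 → term k ≈ 0ℤ
      middle zero    _   _   k≢0 = ⊥-elim (k≢0 refl)
      middle (suc k) k<p k≢p _   =
        ≈-trans (*-cong (prime∣binomial (suc k) (s≤s z≤n) (ℕP.≤∧≢⇒< (ℕP.≤-pred k<p) k≢p)) ≈-refl)
                (≈-reflexive (ℤP.*-zeroˡ (a ^ suc k * 1ℤ ^ (p ∸ suc k))))
      last : term p ≡ a ^ p
      last = trans (cong (λ c → + c * (a ^ p * 1ℤ ^ (p ∸ p))) (nCn≡1 p))
             (trans (ℤP.*-identityˡ (a ^ p * 1ℤ ^ (p ∸ p)))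
                    (trans (cong (a ^ p *_) (ℤP.^-zeroˡ (p ∸ p))) (ℤP.*-identityʳ (a ^ p))))
      first : term 0 ≡ 1ℤ
      first = trans (ℤP.*-identityˡ (1ℤ * 1ℤ ^ p)) (trans (ℤP.*-identityˡ (1ℤ ^ p)) (ℤP.^-zeroˡ p))

  fermat : ∀ a → (+ a) ^ p ≈ + a
  fermat zero    = ≈-reflexive (ℤP.*-zeroˡ ((+ 0) ^ n))
  fermat (suc a) = begin
    (+ suc a) ^ p      ≡⟨ cong (_^ p) (+suc a) ⟩
    (+ a + 1ℤ) ^ p     ≈⟨ freshman (+ a) ⟩
    (+ a) ^ p + 1ℤ     ≈⟨ +-cong (fermat a) ≈-refl ⟩
    + a + 1ℤ           ≡⟨ +suc a ⟨
    + suc a            ∎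
    where
      open ≈-Reasoning ≈-setoid
      +suc : ∀ a → + suc a ≡ + a + 1ℤ
      +suc a = trans (cong +_ (ℕP.+-comm 1 a)) (ℤP.pos-+ a 1)

  fermat-unit : ∀ a → ¬ (+ a ≈ 0ℤ) → (+ a) ^ n ≈ 1ℤ
  fermat-unit a a≉0 = cancelˡ (+ a) a≉0 (≈-trans (fermat a) (≈-reflexive (sym (ℤP.*-identityʳ (+ a)))))

alternating-sum : ∀ K → ∑ (2 ℕ.* K) ε ≡ 0ℤ
alternating-sum zero    = refl
alternating-sum (suc K) =
  trans (cong (λ M → ∑ M ε) (ℕP.*-suc 2 K))
        (trans (cong (λ u → u + ε (2 ℕ.* K) + -1ℤ * ε (2 ℕ.* K)) (alternating-sum K)) (cancel (ε (2 ℕ.* K))))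
  where
    cancel : ∀ e → 0ℤ + e + -1ℤ * e ≡ 0ℤ
    cancel = solve-∀

eulerTable-stable : ∀ n m → m ≤ n → eulerTable (suc n) m ≡ eulerTable n m
eulerTable-stable n m m≤n with m ℕ.≤ᵇ n | ℕP.≤⇒≤ᵇ m≤n
... | true | _ = refl

eulerTable-correct : ∀ n m → m ≤ n → eulerTable n m ≡ E m
eulerTable-correct n m m≤n with ℕP.m≤n⇒m<n∨m≡n m≤n
... | inj₂ refl = refl
eulerTable-correct (suc n) m _ | inj₁ (s≤s m≤n) =
  trans (eulerTable-stable n m m≤n) (eulerTable-correct n m m≤n)

euler-recurrence : ∀ n → E (suc n) ≡ - ∑ (suc n / 2) (λ i → + (suc n C (2 ℕ.* suc i)) * E (suc n ∸ 2 ℕ.* suc i))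
euler-recurrence n with suc n ℕ.≤ᵇ n in eq
... | true  = ⊥-elim (ℕP.n≮n n (ℕP.≤ᵇ⇒≤ (suc n) n (subst Bool.T (sym eq) tt)))
... | false = cong -_ (trans (sum1≡∑ (suc n / 2) _) (∑-ext (suc n / 2) λ i →
                cong (+ (suc n C (2 ℕ.* suc i)) *_) (eulerTable-correct n _ (ℕP.m∸n≤m n (i ℕ.+ suc (i ℕ.+ 0))))))

H : ℕ → ℤ → ℤ → ℤ
H zero    x y = 1ℤ
H (suc n) x y = y * H n x y + x ^ suc n

H-sum : ∀ n x y → ∑ (suc n) (λ k → x ^ k * y ^ (n ∸ k)) ≡ H n x y
H-sum zero    x y = trans (ℤP.+-identityˡ _) (ℤP.*-identityˡ 1ℤ)
H-sum (suc n) x y = begin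
  ∑ (suc n) (λ k → x ^ k * y ^ (suc n ∸ k)) + x ^ suc n * y ^ (n ∸ n)
    ≡⟨ cong₂ _+_ factor-y (trans (cong (λ e → x ^ suc n * y ^ e) (ℕP.n∸n≡0 n)) (ℤP.*-identityʳ (x ^ suc n))) ⟩
  y * ∑ (suc n) (λ k → x ^ k * y ^ (n ∸ k)) + x ^ suc n
    ≡⟨ cong (λ u → y * u + x ^ suc n) (H-sum n x y) ⟩
  y * H n x y + x ^ suc n ∎
  where
    open ≡-Reasoning
    swap : ∀ y a b → a * (y * b) ≡ y * (a * b)
    swap = solve-∀
    factor-y : ∑ (suc n) (λ k → x ^ k * y ^ (suc n ∸ k)) ≡ y * ∑ (suc n) (λ k → x ^ k * y ^ (n ∸ k))
    factor-y = trans (∑-cong (suc n) λ k k≤n →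
                       trans (cong (λ e → x ^ k * y ^ e) (ℕP.+-∸-assoc 1 (ℕP.≤-pred k≤n)))
                             (swap y (x ^ k) (y ^ (n ∸ k))))
                     (sym (∑-*ˡ (suc n) y _))

H-difference : ∀ n x y → (x - y) * H n x y ≡ x ^ suc n - y ^ suc n
H-difference zero    x y = unit x y
  where
    unit : ∀ x y → (x - y) * 1ℤ ≡ x * 1ℤ - y * 1ℤ
    unit = solve-∀
H-difference (suc n) x y = begin
  (x - y) * (y * H n x y + x ^ suc n)         ≡⟨ expand x y (H n x y) (x ^ suc n) ⟩
  y * ((x - y) * H n x y) + (x - y) * x ^ suc n ≡⟨ cong (λ u → y * u + (x - y) * x ^ suc n) (H-difference n x y) ⟩
  y * (x ^ suc n - y ^ suc n) + (x - y) * x ^ suc n ≡⟨ collect x y (x ^ suc n) (y ^ suc n) ⟩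
  x * x ^ suc n - y * y ^ suc n                ∎
  where
    open ≡-Reasoning
    expand : ∀ x y P X → (x - y) * (y * P + X) ≡ y * ((x - y) * P) + (x - y) * X
    expand = solve-∀
    collect : ∀ x y X Y → y * (X - Y) + (x - y) * X ≡ x * X - y * Y
    collect = solve-∀

H-diagonal : ∀ n x → H n x x ≡ + suc n * x ^ n
H-diagonal zero    x = refl
H-diagonal (suc n) x =
  trans (cong (λ u → x * u + x ^ suc n) (H-diagonal n x))
        (trans (collect x (+ suc n) (x ^ n)) (cong (_* (x * x ^ n)) (sym (ℤP.pos-+ 1 (suc n)))))
  where
    collect : ∀ x k X → x * (k * X) + x * X ≡ (+ 1 + k) * (x * X)
    collect = solve-∀

H-origin : ∀ n → H n 0ℤ 0ℤ ≡ 0ℤ ^ n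
H-origin zero    = refl
H-origin (suc n) = trans (cong (_+ 0ℤ ^ suc n) (ℤP.*-zeroˡ (H n 0ℤ 0ℤ))) (ℤP.+-identityˡ (0ℤ ^ suc n))

module HPeriodicity (p : ℕ) where
  open Congruence p

  H-cong : ∀ n {x x′ y y′} → x ≈ x′ → y ≈ y′ → H n x y ≈ H n x′ y′
  H-cong zero    _  _  = ≈-refl
  H-cong (suc n) ex ey = +-cong (*-cong ey (H-cong n ex ey)) (^-cong (suc n) ex)

  -- A unit x of order dividing e: H_{m+e}(x,x) - H_m(x,x) = (m+e+1)x^(m+e) - (m+1)x^m ≡ e x^m.
  H-step-diagonal-unit : ∀ m e x → x ^ e ≈ 1ℤ → H (m ℕ.+ e) x x - H m x x ≈ + e * x ^ m
  H-step-diagonal-unit m e x xᵉ≈1 = begin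
    H (m ℕ.+ e) x x - H m x x
      ≡⟨ cong₂ _-_ (H-diagonal (m ℕ.+ e) x) (H-diagonal m x) ⟩
    + suc (m ℕ.+ e) * x ^ (m ℕ.+ e) - + suc m * x ^ m
      ≡⟨ cong (λ u → + suc (m ℕ.+ e) * u - + suc m * x ^ m) (ℤP.^-distribˡ-+-* x m e) ⟩
    + suc (m ℕ.+ e) * (x ^ m * x ^ e) - + suc m * x ^ m
      ≈⟨ -‿cong (*-cong (≈-refl {+ suc (m ℕ.+ e)}) (*-cong (≈-refl {x ^ m}) xᵉ≈1)) ≈-refl ⟩
    + suc (m ℕ.+ e) * (x ^ m * 1ℤ) - + suc m * x ^ m
      ≡⟨ cong (λ c → c * (x ^ m * 1ℤ) - + suc m * x ^ m) (ℤP.pos-+ (suc m) e) ⟩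
    (+ suc m + + e) * (x ^ m * 1ℤ) - + suc m * x ^ m
      ≡⟨ collect (+ suc m) (+ e) (x ^ m) ⟩
    + e * x ^ m ∎
    where
      open ≈-Reasoning ≈-setoid
      collect : ∀ k e X → (k + e) * (X * 1ℤ) - k * X ≡ e * X
      collect = solve-∀

  -- At x ≡ 0 only the constant term of H_m survives, so the step is -x^m.
  H-step-diagonal-zero : ∀ m e x → 0 < e → x ≈ 0ℤ → H (m ℕ.+ e) x x - H m x x ≈ - x ^ m
  H-step-diagonal-zero m (suc e) x _ x≈0 = begin
    H (m ℕ.+ suc e) x x - H m x x         ≈⟨ -‿cong (H-cong (m ℕ.+ suc e) x≈0 x≈0) (H-cong m x≈0 x≈0) ⟩
    H (m ℕ.+ suc e) 0ℤ 0ℤ - H m 0ℤ 0ℤ     ≡⟨ cong₂ _-_ (H-origin (m ℕ.+ suc e)) (H-origin m) ⟩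
    0ℤ ^ (m ℕ.+ suc e) - 0ℤ ^ m            ≡⟨ cong (λ k → 0ℤ ^ k - 0ℤ ^ m) (ℕP.+-suc m e) ⟩
    0ℤ * 0ℤ ^ (m ℕ.+ e) - 0ℤ ^ m           ≡⟨ cong (_- 0ℤ ^ m) (ℤP.*-zeroˡ (0ℤ ^ (m ℕ.+ e))) ⟩
    0ℤ - 0ℤ ^ m                           ≡⟨ ℤP.+-identityˡ (- 0ℤ ^ m) ⟩
    - 0ℤ ^ m                              ≈⟨ neg-cong (^-cong m (≈-sym x≈0)) ⟩
    - x ^ m                               ∎
    where open ≈-Reasoning ≈-setoid

  -- Off the diagonal, (x - y) H_m(x, y) = x^(m+1) - y^(m+1) is e-periodic in m
  -- when x^(e+1) ≡ x and y^(e+1) ≡ y; for prime p the factor x - y cancels.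
  H-step-off-diagonal : Prime p → ∀ m e x y → ¬ (x ≈ y) → x ^ suc e ≈ x → y ^ suc e ≈ y →
                        H (m ℕ.+ e) x y ≈ H m x y
  H-step-off-diagonal p-prime m e x y x≉y xᵉ⁺¹≈x yᵉ⁺¹≈y =
    cancelˡ (x - y) (λ x-y≈0 → x≉y (-≈0⇒≈ x-y≈0)) (begin
    (x - y) * H (m ℕ.+ e) x y                ≡⟨ H-difference (m ℕ.+ e) x y ⟩
    x ^ suc (m ℕ.+ e) - y ^ suc (m ℕ.+ e)    ≈⟨ -‿cong (period x xᵉ⁺¹≈x) (period y yᵉ⁺¹≈y) ⟩
    x ^ suc m - y ^ suc m                    ≡⟨ H-difference m x y ⟨
    (x - y) * H m x y                        ∎)
    where
      open ≈-Reasoning ≈-setoid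
      open PrimeModulus p-prime
      period : ∀ z → z ^ suc e ≈ z → z ^ suc (m ℕ.+ e) ≈ z ^ suc m
      period z zᵉ⁺¹≈z = begin
        z ^ suc (m ℕ.+ e)   ≡⟨ cong (z ^_) (sym (ℕP.+-suc m e)) ⟩
        z ^ (m ℕ.+ suc e)   ≡⟨ ℤP.^-distribˡ-+-* z m (suc e) ⟩
        z ^ m * z ^ suc e   ≈⟨ *-cong (≈-refl {z ^ m}) zᵉ⁺¹≈z ⟩
        z ^ m * z           ≡⟨ ℤP.*-comm (z ^ m) z ⟩
        z ^ suc m           ∎

-- From here on p = 2h + 1 is an odd prime, h = g + 1 ≥ 1; a_j = 2j + 1.
module OddPrime (g : ℕ) (p-prime : Prime (suc (2 ℕ.* suc g))) where

  h = suc g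
  p = suc (2 ℕ.* h)
  open Congruence p
  open PrimeModulus p-prime
  open Fermat (2 ℕ.* h) p-prime using (fermat; fermat-unit)
  open HPeriodicity p

  a : ℕ → ℤ
  a j = + suc (2 ℕ.* j)

  2<p : 2 < p
  2<p = s≤s (ℕP.*-monoʳ-≤ 2 (s≤s (z≤n {g})))

  2≉0 : ¬ (+ 2 ≈ 0ℤ)
  2≉0 2≈0 with small≈0 2≈0 2<p
  ... | ()

  halve : ∀ {u} → + 2 * u ≈ 0ℤ → u ≈ 0ℤ
  halve {u} 2u≈0 = cancelˡ (+ 2) 2≉0 (≈-trans 2u≈0 (≈-reflexive (sym (ℤP.*-zeroʳ (+ 2)))))

  F : ℕ → ℤ
  F n = ∑ p (λ j → ε j * a j ^ n)

  F-zero : F 0 ≡ 1ℤ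
  F-zero = begin
    ∑ p (λ j → ε j * 1ℤ)     ≡⟨ ∑-ext p (λ j → ℤP.*-identityʳ (ε j)) ⟩
    ∑ (2 ℕ.* h) ε + ε (2 ℕ.* h) ≡⟨ cong₂ _+_ (alternating-sum h) (ε-even h) ⟩
    0ℤ + 1ℤ                   ≡⟨⟩
    1ℤ                        ∎
    where open ≡-Reasoning

  -- For N ≥ 1, Σ_{j ≤ N/2} C(N, 2j) F_(N-2j) ≡ 0.  Twice the sum is the even part
  -- of the expansions of (a_l ± 1)^N, i.e. Σ_l (-1)^l ((2l+2)^N + (2l)^N), which
  -- telescopes to w_0 - w_p for w_l = (-1)^l (2l)^N; both ends vanish modulo p.
  F-recurrence : ∀ n → ∑ (suc (suc n / 2)) (λ j → + (suc n C (2 ℕ.* j)) * F (suc n ∸ 2 ℕ.* j)) ≈ 0ℤ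
  F-recurrence n = halve doubled
    where
      N = suc n
      K = suc (N / 2)
      c : ℕ → ℤ
      c j = + (N C (2 ℕ.* j))
      e : ℕ → ℕ
      e j = N ∸ 2 ℕ.* j
      w : ℕ → ℤ
      w l = ε l * (+ (2 ℕ.* l)) ^ N
      even-part : ∀ l → + 2 * ∑ K (λ j → c j * (ε l * a l ^ e j)) ≡ ε l * ((1ℤ + a l) ^ N + (-1ℤ + a l) ^ N)
      even-part l = begin
        + 2 * ∑ K (λ j → c j * (ε l * a l ^ e j))  ≡⟨ cong (+ 2 *_) (∑-ext K (λ j → swap (c j) (ε l) (a l ^ e j))) ⟩
        + 2 * ∑ K (λ j → ε l * (c j * a l ^ e j))  ≡⟨ cong (+ 2 *_) (∑-*ˡ K (ε l) _) ⟨
        + 2 * (ε l * ∑ K (λ j → c j * a l ^ e j))  ≡⟨ swap (+ 2) (ε l) _ ⟩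
        ε l * (+ 2 * ∑ K (λ j → c j * a l ^ e j))  ≡⟨ cong (ε l *_) (even-binomial N (a l)) ⟨
        ε l * ((1ℤ + a l) ^ N + (-1ℤ + a l) ^ N)   ∎
        where
          open ≡-Reasoning
          swap : ∀ x y z → x * (y * z) ≡ y * (x * z)
          swap = solve-∀
      neighbours : ∀ l → ε l * ((1ℤ + a l) ^ N + (-1ℤ + a l) ^ N) ≡ - (w (suc l) - w l)
      neighbours l =
        trans (cong (λ u → ε l * (u ^ N + (+ (2 ℕ.* l)) ^ N)) (cong +_ (sym (ℕP.*-suc 2 l))))
              (collect (ε l) ((+ (2 ℕ.* suc l)) ^ N) ((+ (2 ℕ.* l)) ^ N))
        where
          collect : ∀ s A B → s * (A + B) ≡ - (-1ℤ * s * A - s * B)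
          collect = solve-∀
      w-p≈0 : w p ≈ 0ℤ
      w-p≈0 = ≈-trans (*-cong (≈-refl {ε p}) (*-cong 2p≈0 ≈-refl)) (≈-reflexive (vanish (ε p) ((+ (2 ℕ.* p)) ^ n)))
        where
          2p≈0 : + (2 ℕ.* p) ≈ 0ℤ
          2p≈0 = ≈-trans (≈-reflexive (ℤP.pos-* 2 p))
                         (≈-trans (*-cong (≈-refl {+ 2}) p≈0) (≈-reflexive (ℤP.*-zeroʳ (+ 2))))
          vanish : ∀ s y → s * (0ℤ * y) ≡ 0ℤ
          vanish = solve-∀
      doubled : + 2 * ∑ K (λ j → c j * F (e j)) ≈ 0ℤ
      doubled = begin
        + 2 * ∑ K (λ j → c j * F (e j))
          ≡⟨ cong (+ 2 *_) (∑-ext K (λ j → ∑-*ˡ p (c j) _)) ⟩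
        + 2 * ∑ K (λ j → ∑ p (λ l → c j * (ε l * a l ^ e j)))
          ≡⟨ cong (+ 2 *_) (∑-swap K p _) ⟩
        + 2 * ∑ p (λ l → ∑ K (λ j → c j * (ε l * a l ^ e j)))
          ≡⟨ ∑-*ˡ p (+ 2) _ ⟩
        ∑ p (λ l → + 2 * ∑ K (λ j → c j * (ε l * a l ^ e j)))
          ≡⟨ ∑-ext p even-part ⟩
        ∑ p (λ l → ε l * ((1ℤ + a l) ^ N + (-1ℤ + a l) ^ N))
          ≡⟨ ∑-ext p neighbours ⟩
        ∑ p (λ l → - (w (suc l) - w l))
          ≡⟨ ∑-neg p _ ⟨
        - ∑ p (λ l → w (suc l) - w l)
          ≡⟨ cong -_ (∑-telescope p w) ⟩
        - (w p - w 0)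
          ≈⟨ neg-cong (-‿cong w-p≈0 (≈-reflexive (ℤP.*-zeroʳ (ε 0)))) ⟩
        - (0ℤ - 0ℤ)
          ≡⟨⟩
        0ℤ ∎
        where open ≈-Reasoning ≈-setoid

  -- E_n ≡ F_n (mod p), by strong induction: both sides satisfy the same
  -- recurrence with the same initial value.
  E≈F : ∀ n → E n ≈ F n
  E≈F = <-rec (λ n → E n ≈ F n) step
    where
      step : ∀ n → (∀ {m} → m < n → E m ≈ F m) → E n ≈ F n
      step zero    _  = ≈-reflexive (sym F-zero)
      step (suc n) IH = begin
        E (suc n)                  ≡⟨ euler-recurrence n ⟩
        - ∑ K (λ i → c i * E (r i)) ≈⟨ neg-cong (∑-cong≈ K (λ i _ → *-cong (≈-refl {c i}) (IH {r i} (r<n+1 i)))) ⟩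
        - S                        ≡⟨ rearrange (F (suc n)) S ⟩
        F (suc n) - (F (suc n) + S) ≈⟨ -‿cong (≈-refl {F (suc n)}) whole≈0 ⟩
        F (suc n) - 0ℤ              ≡⟨ ℤP.+-identityʳ (F (suc n)) ⟩
        F (suc n)                  ∎
        where
          open ≈-Reasoning ≈-setoid
          K = suc n / 2
          c : ℕ → ℤ
          c i = + (suc n C (2 ℕ.* suc i))
          r : ℕ → ℕ
          r i = suc n ∸ 2 ℕ.* suc i
          r<n+1 : ∀ i → r i < suc n
          r<n+1 i = s≤s (ℕP.m∸n≤m n (i ℕ.+ suc (i ℕ.+ 0)))
          S = ∑ K (λ i → c i * F (r i))
          rearrange : ∀ x y → - y ≡ x - (x + y)
          rearrange = solve-∀
          whole≈0 : F (suc n) + S ≈ 0ℤ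
          whole≈0 = ≈-trans (≈-reflexive (sym (trans (∑-shift K _) (cong (_+ S) (ℤP.*-identityˡ (F (suc n)))))))
                            (F-recurrence n)

  x : ℕ → ℤ
  x j = a j ^ 2

  h<p : h < p
  h<p = s≤s (ℕP.m≤m+n h (1 ℕ.* h))

  -- a_j = 2j + 1 < 2p is divisible by p only for j = h.
  a≈0⇒h : ∀ {j} → j < p → a j ≈ 0ℤ → j ≡ h
  a≈0⇒h {j} j<p aⱼ≈0 = ℕP.*-cancelˡ-≡ j h 2 (ℕP.suc-injective (multiple-below-2p aⱼ≈0 a<2p))
    where
      a<2p : suc (2 ℕ.* j) < p ℕ.+ p
      a<2p = subst₂ _≤_ (ℕP.*-suc 2 j) (cong (p ℕ.+_) (ℕP.+-identityʳ p)) (ℕP.*-monoʳ-≤ 2 j<p)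

  x-difference : ∀ j l → x j - x l ≡ (+ 2 * (+ j - + l)) * (+ 2 * + suc (j ℕ.+ l))
  x-difference j l = trans (cong₂ (λ u v → u * (u * 1ℤ) - v * (v * 1ℤ)) (odd j) (odd l)) (factor (+ j) (+ l))
    where
      odd : ∀ j → a j ≡ 1ℤ + + 2 * + j
      odd j = cong (_+_ 1ℤ) (ℤP.pos-* 2 j)
      factor : ∀ J L → (1ℤ + + 2 * J) * ((1ℤ + + 2 * J) * 1ℤ) - (1ℤ + + 2 * L) * ((1ℤ + + 2 * L) * 1ℤ)
                       ≡ (+ 2 * (J - L)) * (+ 2 * (1ℤ + (J + L)))
      factor = solve-∀

  -- Consequently x_j ≡ x_l (j, l < p) exactly when l = j or l = 2h - j.
  -- mirror j = 2h - j, the other index with the same square class.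
  mirror : ℕ → ℕ
  mirror j = 2 ℕ.* h ∸ j

  mirror<p : ∀ j → mirror j < p
  mirror<p j = s≤s (ℕP.m∸n≤m (2 ℕ.* h) j)

  +mirror : ∀ {j} → j < p → j ℕ.+ mirror j ≡ 2 ℕ.* h
  +mirror j<p = ℕP.m+[n∸m]≡n (ℕP.≤-pred j<p)

  x≈⇒mirror : ∀ {j l} → j < p → l < p → x j ≈ x l → l ≡ j ⊎ l ≡ mirror j
  x≈⇒mirror {j} {l} j<p l<p xⱼ≈xₗ =
    Sum.map (λ j-l≈0 → sym (≈⇒≡ j<p l<p (-≈0⇒≈ (halve j-l≈0))))
            (λ j+l+1≈0 → sym (trans (cong (_∸ j) (sym (j+l≡2h j+l+1≈0))) (ℕP.m+n∸m≡n j l)))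
            (zero-divisor (+ 2 * (+ j - + l)) (+ 2 * + suc (j ℕ.+ l))
                          (≈-trans (≈-reflexive (sym (x-difference j l))) (≈⇒-≈0 xⱼ≈xₗ)))
    where
      j+l<2p : suc (j ℕ.+ l) < p ℕ.+ p
      j+l<2p = subst (_≤ p ℕ.+ p) (cong suc (ℕP.+-suc j l)) (ℕP.+-mono-≤ j<p l<p)
      j+l≡2h : + 2 * + suc (j ℕ.+ l) ≈ 0ℤ → j ℕ.+ l ≡ 2 ℕ.* h
      j+l≡2h 2[j+l+1]≈0 = ℕP.suc-injective (multiple-below-2p (halve 2[j+l+1]≈0) j+l<2p)

  x-mirror : ∀ {j} → j < p → x (mirror j) ≈ x j
  x-mirror {j} j<p = -≈0⇒≈ (≈-trans (≈-reflexive (x-difference (mirror j) j))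
                                      (≈-trans (*-cong (≈-refl {A}) (*-cong (≈-refl {+ 2}) p-sum≈0))
                                               (≈-reflexive (vanish A))))
    where
      A = + 2 * (+ mirror j - + j)
      p-sum≈0 : + suc (mirror j ℕ.+ j) ≈ 0ℤ
      p-sum≈0 = ≈-trans (≈-reflexive (cong (λ k → + suc k) (trans (ℕP.+-comm (mirror j) j) (+mirror j<p)))) p≈0
      vanish : ∀ A → A * (+ 2 * 0ℤ) ≡ 0ℤ
      vanish = solve-∀

  x-fermat : ∀ j → x j ^ suc h ≈ x j
  x-fermat j = begin
    x j ^ suc h             ≡⟨ ℤP.^-*-assoc (a j) 2 (suc h) ⟩
    a j ^ (2 ℕ.* suc h)     ≡⟨ cong (a j ^_) (ℕP.*-suc 2 h) ⟩
    a j * a j ^ p           ≈⟨ *-cong (≈-refl {a j}) (fermat (suc (2 ℕ.* j))) ⟩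
    a j * a j               ≡⟨ cong (a j *_) (ℤP.*-identityʳ (a j)) ⟨
    x j                     ∎
    where open ≈-Reasoning ≈-setoid

  x-unit : ∀ {j} → j < p → j ≢ h → x j ^ h ≈ 1ℤ
  x-unit {j} j<p j≢h = ≈-trans (≈-reflexive (ℤP.^-*-assoc (a j) 2 h))
                               (fermat-unit (suc (2 ℕ.* j)) (λ aⱼ≈0 → j≢h (a≈0⇒h j<p aⱼ≈0)))

  -- Power sums U_k = Σ_{j < p} a_j^k of the odd numbers below 2p.  The a_j run
  -- over all residues modulo p, and U_k ≡ 0 for k < p - 1, U_(p-1) ≡ -1.
  U : ℕ → ℤ
  U k = ∑ p (λ j → a j ^ k)

  power-difference : ∀ k j → a (suc j) ^ suc k - a j ^ suc k
                             ≡ ∑ (suc k) (λ i → + (suc k C i) * (+ 2) ^ (suc k ∸ i) * a j ^ i)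
  power-difference k j = begin
    a (suc j) ^ suc k - a j ^ suc k
      ≡⟨ cong (λ u → u ^ suc k - a j ^ suc k) a-suc ⟩
    (a j + + 2) ^ suc k - a j ^ suc k
      ≡⟨ cong (_- a j ^ suc k) (binomial-theorem (a j) (+ 2) (suc k)) ⟩
    ∑ (suc k) term + term (suc k) - a j ^ suc k
      ≡⟨ cong (λ u → ∑ (suc k) term + u - a j ^ suc k) top ⟩
    ∑ (suc k) term + a j ^ suc k - a j ^ suc k
      ≡⟨ cancel (∑ (suc k) term) (a j ^ suc k) ⟩
    ∑ (suc k) term
      ≡⟨ ∑-ext (suc k) (λ i → swap (+ (suc k C i)) (a j ^ i) ((+ 2) ^ (suc k ∸ i))) ⟩
    ∑ (suc k) (λ i → + (suc k C i) * (+ 2) ^ (suc k ∸ i) * a j ^ i) ∎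
    where
      open ≡-Reasoning
      a-suc : a (suc j) ≡ a j + + 2
      a-suc = cong +_ (trans (cong suc (ℕP.*-suc 2 j)) (ℕP.+-comm 2 (suc (2 ℕ.* j))))
      term : ℕ → ℤ
      term i = + (suc k C i) * (a j ^ i * (+ 2) ^ (suc k ∸ i))
      top : term (suc k) ≡ a j ^ suc k
      top = trans (cong₂ (λ u v → + u * (a j ^ suc k * (+ 2) ^ v)) (nCn≡1 (suc k)) (ℕP.n∸n≡0 k))
                  (trans (ℤP.*-identityˡ (a j ^ suc k * 1ℤ)) (ℤP.*-identityʳ (a j ^ suc k)))
      cancel : ∀ S A → S + A - A ≡ S
      cancel = solve-∀
      swap : ∀ b A t → b * (A * t) ≡ b * t * A
      swap = solve-∀

  -- Σ_{i ≤ k} C(k+1, i) 2^(k+1-i) U_i = Σ_j (a_(j+1)^(k+1) - a_j^(k+1)) ≡ 0, as a_p ≡ 1 = a_0.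
  U-relation : ∀ k → ∑ (suc k) (λ i → + (suc k C i) * (+ 2) ^ (suc k ∸ i) * U i) ≈ 0ℤ
  U-relation k = begin
    ∑ (suc k) (λ i → c i * U i)                   ≡⟨ ∑-ext (suc k) (λ i → ∑-*ˡ p (c i) _) ⟩
    ∑ (suc k) (λ i → ∑ p (λ j → c i * a j ^ i))   ≡⟨ ∑-swap (suc k) p _ ⟩
    ∑ p (λ j → ∑ (suc k) (λ i → c i * a j ^ i))   ≡⟨ ∑-ext p (λ j → sym (power-difference k j)) ⟩
    ∑ p (λ j → a (suc j) ^ suc k - a j ^ suc k)   ≡⟨ ∑-telescope p (λ j → a j ^ suc k) ⟩
    a p ^ suc k - a 0 ^ suc k                     ≈⟨ -‿cong (^-cong (suc k) a-p≈1) ≈-refl ⟩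
    1ℤ ^ suc k - 1ℤ ^ suc k                       ≡⟨ ℤP.+-inverseʳ (1ℤ ^ suc k) ⟩
    0ℤ                                            ∎
    where
      open ≈-Reasoning ≈-setoid
      c : ℕ → ℤ
      c i = + (suc k C i) * (+ 2) ^ (suc k ∸ i)
      a-p≈1 : a p ≈ 1ℤ
      a-p≈1 = ≈-trans (≈-reflexive (ℤP.pos-+ 1 (2 ℕ.* p)))
                      (≈-trans (+-cong (≈-refl {1ℤ}) (≈-trans (≈-reflexive (ℤP.pos-* 2 p)) (*-cong (≈-refl {+ 2}) p≈0)))
                               (≈-reflexive (ℤP.+-identityʳ 1ℤ)))

  -- By strong induction on k: in U-relation all U_i with i < k vanish, leaving
  -- (k+1)·2·U_k ≡ 0, and k + 1 < p is invertible.
  U-vanish : ∀ k → k < 2 ℕ.* h → U k ≈ 0ℤ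
  U-vanish = <-rec (λ k → k < 2 ℕ.* h → U k ≈ 0ℤ) step
    where
      step : ∀ k → (∀ {i} → i < k → i < 2 ℕ.* h → U i ≈ 0ℤ) → k < 2 ℕ.* h → U k ≈ 0ℤ
      step k IH k<2h = halve (cancelˡ (+ suc k) k+1≉0 (begin
        + suc k * (+ 2 * U k)         ≡⟨ regroup (+ suc k) (U k) ⟩
        + suc k * (+ 2) ^ 1 * U k      ≡⟨ cong₂ (λ u v → + u * (+ 2) ^ v * U k) (sym C[k+1,k]) (sym (ℕP.m+n∸n≡m 1 k)) ⟩
        f k                           ≈⟨ ∑-support₁ (suc k) f k ℕP.≤-refl lower ⟨
        ∑ (suc k) f                   ≈⟨ U-relation k ⟩
        0ℤ                            ≡⟨ ℤP.*-zeroʳ (+ suc k) ⟨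
        + suc k * 0ℤ                  ∎))
        where
          open ≈-Reasoning ≈-setoid
          f : ℕ → ℤ
          f i = + (suc k C i) * (+ 2) ^ (suc k ∸ i) * U i
          lower : ∀ i → i < suc k → i ≢ k → f i ≈ 0ℤ
          lower i i<k+1 i≢k =
            ≈-trans (*-cong (≈-refl {+ (suc k C i) * (+ 2) ^ (suc k ∸ i)}) (IH i<k (ℕP.<-trans i<k k<2h)))
                    (≈-reflexive (ℤP.*-zeroʳ (+ (suc k C i) * (+ 2) ^ (suc k ∸ i))))
            where i<k = ℕP.≤∧≢⇒< (ℕP.≤-pred i<k+1) i≢k
          k+1≉0 : ¬ (+ suc k ≈ 0ℤ)
          k+1≉0 k+1≈0 with small≈0 k+1≈0 (s≤s k<2h)
          ... | ()
          C[k+1,k] : suc k C k ≡ suc k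
          C[k+1,k] = trans (nCk≡nC[n∸k] (ℕP.n≤1+n k)) (trans (cong (suc k C_) (ℕP.m+n∸n≡m 1 k)) (nC1≡n (suc k)))
          regroup : ∀ K u → K * (+ 2 * u) ≡ K * (+ 2 * 1ℤ) * u
          regroup = solve-∀

  -- U_(2h) ≡ -1: every a_j^(2h) is 1 by Fermat, except a_h = p.
  U-top : U (2 ℕ.* h) ≈ -1ℤ
  U-top = begin
    U (2 ℕ.* h)                   ≡⟨ regroup (U (2 ℕ.* h)) (+ p * 1ℤ) ⟩
    (U (2 ℕ.* h) - + p * 1ℤ) + + p * 1ℤ
      ≡⟨ cong (λ u → U (2 ℕ.* h) - u + + p * 1ℤ) (sym (∑-const p 1ℤ)) ⟩
    (U (2 ℕ.* h) - ∑ p (λ _ → 1ℤ)) + + p * 1ℤ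
      ≡⟨ cong (_+ + p * 1ℤ) (∑-- p (λ j → a j ^ (2 ℕ.* h)) (λ _ → 1ℤ)) ⟨
    ∑ p f + + p * 1ℤ              ≈⟨ +-cong (∑-support₁ p f h h<p units) (*-cong p≈0 (≈-refl {1ℤ})) ⟩
    f h + 0ℤ * 1ℤ                 ≈⟨ +-cong (-‿cong (^-cong (2 ℕ.* h) p≈0) ≈-refl) ≈-refl ⟩
    0ℤ ^ (2 ℕ.* h) - 1ℤ + 0ℤ * 1ℤ  ≡⟨ cong (λ u → u - 1ℤ + 0ℤ * 1ℤ) zero-power ⟩
    -1ℤ                           ∎
    where
      open ≈-Reasoning ≈-setoid
      f : ℕ → ℤ
      f j = a j ^ (2 ℕ.* h) - 1ℤ
      units : ∀ j → j < p → j ≢ h → f j ≈ 0ℤ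
      units j j<p j≢h = ≈⇒-≈0 (fermat-unit (suc (2 ℕ.* j)) (λ aⱼ≈0 → j≢h (a≈0⇒h j<p aⱼ≈0)))
      regroup : ∀ u v → u ≡ (u - v) + v
      regroup = solve-∀
      zero-power : 0ℤ ^ (2 ℕ.* h) ≡ 0ℤ
      zero-power = trans (cong (0ℤ ^_) (ℕP.*-suc 2 g)) (ℤP.*-zeroˡ (0ℤ ^ suc (2 ℕ.* g)))

  U-period : ∀ k → 0 < k → U (k ℕ.+ 2 ℕ.* h) ≈ U k
  U-period (suc k) _ = ∑-cong≈ p λ j _ → begin
    a j ^ (suc k ℕ.+ 2 ℕ.* h)   ≡⟨ cong (a j ^_) (sym (ℕP.+-suc k (2 ℕ.* h))) ⟩
    a j ^ (k ℕ.+ p)             ≡⟨ ℤP.^-distribˡ-+-* (a j) k p ⟩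
    a j ^ k * a j ^ p           ≈⟨ *-cong (≈-refl {a j ^ k}) (fermat (suc (2 ℕ.* j))) ⟩
    a j ^ k * a j               ≡⟨ ℤP.*-comm (a j ^ k) (a j) ⟩
    a j ^ suc k                 ∎
    where open ≈-Reasoning ≈-setoid

  -- Unfolding E ≡ F turns s into the double sum
  --   T_m = Σ_{j,l < p} (-1)^(j+l) H_m(x_j, x_l).
  T : ℕ → ℤ
  T m = ∑ p (λ j → ∑ p (λ l → ε j * ε l * H m (x j) (x l)))

  s≈T : ∀ m → s m ≈ T m
  s≈T m = begin
    s m
      ≡⟨ sum0≡∑ m _ ⟩
    ∑ (suc m) (λ k → E (2 ℕ.* k) * E (2 ℕ.* m ∸ 2 ℕ.* k))
      ≈⟨ ∑-cong≈ (suc m) (λ k _ → *-cong (E≈F (2 ℕ.* k)) (E≈F (2 ℕ.* m ∸ 2 ℕ.* k))) ⟩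
    ∑ (suc m) (λ k → F (2 ℕ.* k) * F (2 ℕ.* m ∸ 2 ℕ.* k))
      ≡⟨ ∑-ext (suc m) (λ k → cong₂ _*_ (F-even k) (trans (cong F (sym (ℕP.*-distribˡ-∸ 2 m k))) (F-even (m ∸ k)))) ⟩
    ∑ (suc m) (λ k → G k * G (m ∸ k))
      ≡⟨ ∑-ext (suc m) (λ k → ∑-product p p _ _) ⟩
    ∑ (suc m) (λ k → ∑ p (λ j → ∑ p (λ l → term j l k)))
      ≡⟨ ∑-swap (suc m) p _ ⟩
    ∑ p (λ j → ∑ (suc m) (λ k → ∑ p (λ l → term j l k)))
      ≡⟨ ∑-ext p (λ j → ∑-swap (suc m) p _) ⟩
    ∑ p (λ j → ∑ p (λ l → ∑ (suc m) (term j l)))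
      ≡⟨ ∑-ext p (λ j → ∑-ext p (λ l → inner j l)) ⟩
    T m ∎
    where
      open ≈-Reasoning ≈-setoid
      G : ℕ → ℤ
      G k = ∑ p (λ j → ε j * x j ^ k)
      F-even : ∀ k → F (2 ℕ.* k) ≡ G k
      F-even k = ∑-ext p (λ j → cong (ε j *_) (sym (ℤP.^-*-assoc (a j) 2 k)))
      term : ℕ → ℕ → ℕ → ℤ
      term j l k = (ε j * x j ^ k) * (ε l * x l ^ (m ∸ k))
      regroup : ∀ a b c d → (a * c) * (b * d) ≡ a * b * (c * d)
      regroup = solve-∀
      inner : ∀ j l → ∑ (suc m) (term j l) ≡ ε j * ε l * H m (x j) (x l)
      inner j l = trans (∑-ext (suc m) (λ k → regroup (ε j) (ε l) (x j ^ k) (x l ^ (m ∸ k))))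
                        (trans (sym (∑-*ˡ (suc m) (ε j * ε l) _)) (cong (ε j * ε l *_) (H-sum m (x j) (x l))))

  Δ : ℕ → ℕ → ℕ → ℤ
  Δ m j l = ε j * ε l * (H (m ℕ.+ h) (x j) (x l) - H m (x j) (x l))

  T-difference : ∀ m → T (m ℕ.+ h) - T m ≡ ∑ p (λ j → ∑ p (Δ m j))
  T-difference m =
    trans (sym (∑-- p _ _)) (∑-ext p (λ j → trans (sym (∑-- p _ _)) (∑-ext p (λ l → factor (ε j * ε l) _ _))))
    where
      factor : ∀ e P Q → e * P - e * Q ≡ e * (P - Q)
      factor = solve-∀

  -- Entries with x_l ≢ x_j vanish, since then H_m(x_j, x_l) is h-periodic in m.
  Δ-off-diagonal : ∀ m {j l} → j < p → l < p → l ≢ j → l ≢ mirror j → Δ m j l ≈ 0ℤ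
  Δ-off-diagonal m {j} {l} j<p l<p l≢j l≢j′ =
    ≈-trans (*-cong (≈-refl {ε j * ε l})
                    (≈⇒-≈0 (H-step-off-diagonal p-prime m h (x j) (x l) xⱼ≉xₗ (x-fermat j) (x-fermat l))))
            (≈-reflexive (ℤP.*-zeroʳ (ε j * ε l)))
    where
      xⱼ≉xₗ : ¬ (x j ≈ x l)
      xⱼ≉xₗ xⱼ≈xₗ = Sum.[ l≢j , l≢j′ ]′ (x≈⇒mirror j<p l<p xⱼ≈xₗ)

  -- The entries with x_l ≡ x_j have sign +1 and contribute h x_j^m each
  -- (two of them, l = j and l = 2h - j) when j ≠ h, and -x_h^m when j = h.
  Δ-diagonal-unit : ∀ m {j l} → ε j * ε l ≡ 1ℤ → x l ≈ x j → x j ^ h ≈ 1ℤ → Δ m j l ≈ + h * x j ^ m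
  Δ-diagonal-unit m {j} {l} sign xₗ≈xⱼ unit = begin
    ε j * ε l * (H (m ℕ.+ h) (x j) (x l) - H m (x j) (x l))
      ≈⟨ *-cong (≈-reflexive sign) (-‿cong (H-cong (m ℕ.+ h) ≈-refl xₗ≈xⱼ) (H-cong m ≈-refl xₗ≈xⱼ)) ⟩
    1ℤ * (H (m ℕ.+ h) (x j) (x j) - H m (x j) (x j))
      ≡⟨ ℤP.*-identityˡ _ ⟩
    H (m ℕ.+ h) (x j) (x j) - H m (x j) (x j)
      ≈⟨ H-step-diagonal-unit m h (x j) unit ⟩
    + h * x j ^ m ∎
    where open ≈-Reasoning ≈-setoid

  ε-double : ∀ j → ε j * ε j ≡ 1ℤ
  ε-double j = trans (ε-+ j j) (trans (cong (λ k → ε (j ℕ.+ k)) (sym (ℕP.+-identityʳ j))) (ε-even j))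

  ε-mirror : ∀ {j} → j < p → ε j * ε (mirror j) ≡ 1ℤ
  ε-mirror {j} j<p = trans (ε-+ j (mirror j)) (trans (cong ε (+mirror j<p)) (ε-even h))

  row : ∀ m j → j < p → ∑ p (Δ m j) ≈ - x j ^ m
  row m j j<p with j ≟ h
  ... | yes refl = begin
    ∑ p (Δ m h)
      ≈⟨ ∑-support₁ p (Δ m h) h h<p (λ l l<p l≢h → Δ-off-diagonal m h<p l<p l≢h (subst (l ≢_) (sym mirror-h) l≢h)) ⟩
    ε h * ε h * (H (m ℕ.+ h) (x h) (x h) - H m (x h) (x h))
      ≡⟨ trans (cong (_* D) (ε-double h)) (ℤP.*-identityˡ D) ⟩
    H (m ℕ.+ h) (x h) (x h) - H m (x h) (x h)
      ≈⟨ H-step-diagonal-zero m h (x h) (s≤s z≤n) (^-cong 2 p≈0) ⟩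
    - x h ^ m ∎
    where
      open ≈-Reasoning ≈-setoid
      D = H (m ℕ.+ h) (x h) (x h) - H m (x h) (x h)
      mirror-h : mirror h ≡ h
      mirror-h = trans (cong (_∸ h) (cong (h ℕ.+_) (ℕP.+-identityʳ h))) (ℕP.m+n∸m≡n h h)
  ... | no j≢h = begin
    ∑ p (Δ m j)
      ≈⟨ ∑-support₂ p (Δ m j) j (mirror j) j<p (mirror<p j) j≢j′ (λ l l<p → Δ-off-diagonal m j<p l<p) ⟩
    Δ m j j + Δ m j (mirror j)
      ≈⟨ +-cong (Δ-diagonal-unit m {j} {j} (ε-double j) ≈-refl unit)
                (Δ-diagonal-unit m {j} {mirror j} (ε-mirror j<p) (x-mirror j<p) unit) ⟩
    + h * x j ^ m + + h * x j ^ m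
      ≡⟨ double (+ h) (x j ^ m) ⟩
    (+ h + + h) * x j ^ m
      ≡⟨ cong (λ c → (+ h + c) * x j ^ m) (cong +_ (sym (ℕP.+-identityʳ h))) ⟩
    (+ h + + (h ℕ.+ 0)) * x j ^ m
      ≈⟨ *-cong 2h≈-1 ≈-refl ⟩
    -1ℤ * x j ^ m
      ≡⟨ ℤP.-1*i≡-i (x j ^ m) ⟩
    - x j ^ m ∎
    where
      open ≈-Reasoning ≈-setoid
      unit = x-unit j<p j≢h
      j≢j′ : j ≢ mirror j
      j≢j′ j≡j′ = j≢h (ℕP.*-cancelˡ-≡ j h 2 (trans (cong (j ℕ.+_) (trans (ℕP.+-identityʳ j) j≡j′)) (+mirror j<p)))
      double : ∀ c X → c * X + c * X ≡ (c + c) * X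
      double = solve-∀
      2h≈-1 : + h + + (h ℕ.+ 0) ≈ -1ℤ
      2h≈-1 = ≈-trans (≈-reflexive (shift (+ h) (+ (h ℕ.+ 0)))) (-‿cong p≈0 (≈-refl {1ℤ}))
        where
          shift : ∀ u v → u + v ≡ (1ℤ + (u + v)) - 1ℤ
          shift = solve-∀

  T-step : ∀ m → T (m ℕ.+ h) - T m ≈ - U (2 ℕ.* m)
  T-step m = begin
    T (m ℕ.+ h) - T m             ≡⟨ T-difference m ⟩
    ∑ p (λ j → ∑ p (Δ m j))       ≈⟨ ∑-cong≈ p (λ j j<p → row m j j<p) ⟩
    ∑ p (λ j → - x j ^ m)         ≡⟨ ∑-ext p (λ j → cong -_ (ℤP.^-*-assoc (a j) 2 m)) ⟩
    ∑ p (λ j → - a j ^ (2 ℕ.* m)) ≡⟨ ∑-neg p (λ j → a j ^ (2 ℕ.* m)) ⟨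
    - U (2 ℕ.* m)                 ∎
    where open ≈-Reasoning ≈-setoid

  U-block : ∀ {r} → r < h → ∀ i → U (2 ℕ.* (h ℕ.* suc i ℕ.+ r)) ≈ - δ0 r
  U-block {r} r<h zero = ≈-trans (≈-reflexive (cong U (first-block h r))) (base r r<h)
    where
      first-block : ∀ h r → 2 ℕ.* (h ℕ.* 1 ℕ.+ r) ≡ 2 ℕ.* r ℕ.+ 2 ℕ.* h
      first-block = ℕ-solve-∀
      base : ∀ r → r < h → U (2 ℕ.* r ℕ.+ 2 ℕ.* h) ≈ - δ0 r
      base zero    _   = U-top
      base (suc r) r<h = ≈-trans (U-period (2 ℕ.* suc r) (s≤s z≤n)) (U-vanish (2 ℕ.* suc r) (ℕP.*-monoʳ-< 2 r<h))
  U-block {r} r<h (suc i) =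
    ≈-trans (≈-reflexive (cong U (next-block h i r)))
            (≈-trans (U-period (2 ℕ.* (h ℕ.* suc i ℕ.+ r)) (s≤s z≤n)) (U-block r<h i))
    where
      next-block : ∀ h i r → 2 ℕ.* (h ℕ.* (2 ℕ.+ i) ℕ.+ r) ≡ 2 ℕ.* (h ℕ.* (1 ℕ.+ i) ℕ.+ r) ℕ.+ 2 ℕ.* h
      next-block = ℕ-solve-∀

  -- Summing over the blocks i ≤ q; the block i = 0 contributes U_(2r) ≡ 0.
  U-blocks : ∀ q {r} → r < h → ∑ (suc q) (λ i → U (2 ℕ.* (h ℕ.* i ℕ.+ r))) ≈ - (+ q * δ0 r)
  U-blocks q {r} r<h = begin
    ∑ (suc q) (λ i → U (2 ℕ.* (h ℕ.* i ℕ.+ r)))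
      ≡⟨ ∑-shift q _ ⟩
    U (2 ℕ.* (h ℕ.* 0 ℕ.+ r)) + ∑ q (λ i → U (2 ℕ.* (h ℕ.* suc i ℕ.+ r)))
      ≈⟨ +-cong first (∑-cong≈ q (λ i _ → U-block r<h i)) ⟩
    0ℤ + ∑ q (λ _ → - δ0 r)
      ≡⟨ cong (_+_ 0ℤ) (∑-const q (- δ0 r)) ⟩
    0ℤ + + q * - δ0 r
      ≡⟨ regroup (+ q) (δ0 r) ⟩
    - (+ q * δ0 r) ∎
    where
      open ≈-Reasoning ≈-setoid
      first : U (2 ℕ.* (h ℕ.* 0 ℕ.+ r)) ≈ 0ℤ
      first = ≈-trans (≈-reflexive (cong (λ k → U (2 ℕ.* (k ℕ.+ r))) (ℕP.*-zeroʳ h)))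
                      (U-vanish (2 ℕ.* r) (ℕP.*-monoʳ-< 2 r<h))
      regroup : ∀ Q d → 0ℤ + Q * - d ≡ - (Q * d)
      regroup = solve-∀

  T-blocks : ∀ q r → T (h ℕ.* q ℕ.+ r) - T r ≈ - ∑ q (λ i → U (2 ℕ.* (h ℕ.* i ℕ.+ r)))
  T-blocks q r = begin
    T (h ℕ.* q ℕ.+ r) - T r
      ≡⟨ cong (λ k → T (h ℕ.* q ℕ.+ r) - T (k ℕ.+ r)) (ℕP.*-zeroʳ h) ⟨
    T (h ℕ.* q ℕ.+ r) - T (h ℕ.* 0 ℕ.+ r)
      ≡⟨ ∑-telescope q (λ i → T (h ℕ.* i ℕ.+ r)) ⟨
    ∑ q (λ i → T (h ℕ.* suc i ℕ.+ r) - T (h ℕ.* i ℕ.+ r))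
      ≈⟨ ∑-cong≈ q (λ i _ → ≈-trans (≈-reflexive (cong (λ k → T k - T (h ℕ.* i ℕ.+ r)) (one-more h i r)))
                                     (T-step (h ℕ.* i ℕ.+ r))) ⟩
    ∑ q (λ i → - U (2 ℕ.* (h ℕ.* i ℕ.+ r)))
      ≡⟨ ∑-neg q _ ⟨
    - ∑ q (λ i → U (2 ℕ.* (h ℕ.* i ℕ.+ r))) ∎
    where
      open ≈-Reasoning ≈-setoid
      one-more : ∀ h i r → h ℕ.* (1 ℕ.+ i) ℕ.+ r ≡ (h ℕ.* i ℕ.+ r) ℕ.+ h
      one-more = ℕ-solve-∀

  main-congruence : ∀ q {r} → r < h → s (h ℕ.* suc q ℕ.+ r) - (s r + (+ suc q - + 1) * δ0 r) ≈ 0ℤ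
  main-congruence q {r} r<h = begin
    s N - (s r + (+ suc q - + 1) * δ0 r)
      ≈⟨ -‿cong (s≈T N) (+-cong (s≈T r) ≈-refl) ⟩
    T N - (T r + (+ suc q - + 1) * δ0 r)
      ≡⟨ regroup (T N) (T r) (+ q) (δ0 r) ⟩
    (T N - T r) - + q * δ0 r
      ≈⟨ -‿cong (≈-trans (T-blocks (suc q) r) (neg-cong (U-blocks q r<h))) ≈-refl ⟩
    - - (+ q * δ0 r) - + q * δ0 r
      ≡⟨ cancel (+ q * δ0 r) ⟩
    0ℤ ∎
    where
      open ≈-Reasoning ≈-setoid
      N = h ℕ.* suc q ℕ.+ r
      regroup : ∀ A B Q d → A - (B + ((1ℤ + Q) - + 1) * d) ≡ (A - B) - Q * d
      regroup = solve-∀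
      cancel : ∀ X → - - X - X ≡ 0ℤ
      cancel = solve-∀

odd-prime-form : ∀ p → Prime p → 3 ≤ p → Σ ℕ (λ g → p ≡ suc (2 ℕ.* suc g))
odd-prime-form p p-prime 3≤p with p % 2 | p / 2 | m≡m%n+[m/n]*n p 2 | m%n<n p 2
... | zero | k | p≡k*2 | _ with prime⇒irreducible p-prime (ℕD.divides k p≡k*2)
...   | inj₁ ()
...   | inj₂ 2≡p = ⊥-elim (ℕP.<-irrefl 2≡p 3≤p)
odd-prime-form p p-prime 3≤p | suc zero | zero | p≡1 | _ = ⊥-elim (ℕP.≤⇒≯ (ℕP.≤-reflexive p≡1) (ℕP.<⇒≤ 3≤p))
odd-prime-form p p-prime 3≤p | suc zero | suc g | p≡1+[g+1]*2 | _ = g , trans p≡1+[g+1]*2 (cong suc (ℕP.*-comm (suc g) 2))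
odd-prime-form p p-prime 3≤p | suc (suc _) | _ | _ | s≤s (s≤s ())

corollary1p1 : (p q r : ℕ) → Prime p → 3 ≤ p → 1 ≤ q → 2 ℕ.* r ≤ p ∸ 3 →
    (+ p) ∣ (s ((p ∸ 1) / 2 ℕ.* q ℕ.+ r) - (s r + (+ q - + 1) * δ0 r))
corollary1p1 p (suc q) r p-prime 3≤p _ 2r≤p∸3 with odd-prime-form p p-prime 3≤p
... | g , refl = Signed.∣⇒∣ᵤ (≈0⇒∣ (subst (λ n → s (n ℕ.* suc q ℕ.+ r) - (s r + (+ suc q - + 1) * δ0 r) ≈ 0ℤ)
                                          (sym half-p-1) (main-congruence q r<h)))
  where
    open OddPrime g p-prime using (h; main-congruence)
    open Congruence p using (_≈_; ≈0⇒∣)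
    half-p-1 : (2 ℕ.* h) / 2 ≡ h
    half-p-1 = trans (cong (_/ 2) (ℕP.*-comm 2 h)) (m*n/n≡m h 2)
    r<h : r < h
    r<h = s≤s (ℕP.*-cancelˡ-≤ 2 (ℕP.≤-trans 2r≤p∸3 (ℕP.≤-reflexive (sym (ℕP.*-distribˡ-∸ 2 h 1)))))
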